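{- Let $S$ be a finite set of positive integers with largest element $k$, and suppose the smallest positive integer not in $S$ is $k-c$ for some integer $c>0$. Let $(a_n)_{n\ge1}$ be the $S$-LID sequence. Let $c'$ be an integer with $c'\ge c$ and $k\ge 2(c'+1)$. Then for all $n\ge 1$, \[ a_{n+(k-c')} \ >\ \sum_{\substack{i\ge0\\ i(k-c)<n}} a_{n-i(k-c)} = a_n+a_{n-(k-c)}+a_{n-2(k-c)}+\cdots. \]
   Context: For a set $S$ of positive integers, the $S$-legal index difference ($S$-LID) sequence $(a_n)_{n\ge 1}$ is defined recursively: for each positive integer $n$, $a_n$ is the smallest positive integer that cannot be written as $\sum_{\ell\in L} a_\ell$ for some set $L \subseteq \{1,\dots,n-1\}$ such that $|i-j|\notin S$ for all $i,j\in L$ (the empty sum is $0$). -}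

module Defs where

open import Data.Nat using (ℕ; _+_; _*_; _∸_; _≤_; _<_; ∣_-_∣)
open import Data.Nat.Properties using (_<?_)
open import Data.List using (List; map; filter; upTo)
open import Data.Nat.ListAction using (sum)
open import Data.List.Relation.Unary.All using (All)
open import Data.List.Relation.Unary.Unique.Propositional using (Unique)
open import Data.List.Membership.Propositional using (_∈_; _∉_)
open import Data.Product using (Σ; _×_)
open import Relation.Binary.PropositionalEquality using (_≡_)
open import Relation.Nullary using (¬_)

-- A finite set S of positive integers is represented by a list of naturals
-- (duplicates harmless, membership via _∈_).
-- A sequence (a_n)_{n≥1} is represented by a : ℕ → ℕ; the value a 0 is unused.

LegalIndexSet : List ℕ → ℕ → List ℕ → Set
LegalIndexSet S n L =
  All (λ l → 1 ≤ l × l < n) L × Unique L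
  × (∀ {i j} → i ∈ L → j ∈ L → ∣ i - j ∣ ∉ S)

Representable : List ℕ → (ℕ → ℕ) → ℕ → ℕ → Set
Representable S a n m =
  Σ (List ℕ) (λ L → LegalIndexSet S n L × sum (map a L) ≡ m)

IsLID : List ℕ → (ℕ → ℕ) → Set
IsLID S a = ∀ n → 1 ≤ n →
  (1 ≤ a n) × ¬ Representable S a n (a n)
  × (∀ m → 1 ≤ m → m < a n → Representable S a n m)

stepSum : (ℕ → ℕ) → ℕ → ℕ → ℕ
stepSum a d n = sum (map (λ i → a (n ∸ i * d)) (filter (λ i → i * d <? n) (upTo n)))

module Submission where

-- Since every element of S is at most k, the index m + k can be added to any legal set of
-- indices below m; minimality of a (1 + m + k) then forces a (1 + m + k) ≥ a (m + k) + a m.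
-- The step sum T n = a n + a (n − d) + ⋯ satisfies T n = a n + T (n − d), and for
-- m = n − d ≥ 1, d ≤ k, e ≤ d and k + 2 ≤ d + e, strong induction gives T m < a m + a (1 + m) and
--   T n < a n + a m + a (1 + m) ≤ a (m + k) + a m + a (1 + m) ≤ a (1 + m + k) + a (1 + m)
--       ≤ a (2 + m + k) ≤ a (n + e).
-- The corollary is the case d = k − c, e = k − c′.

open import Defs
open import Data.Bool using (true; false; if_then_else_)
open import Data.Empty using (⊥-elim)
open import Data.List using (List; []; _∷_; [_]; _∷ʳ_; _++_; map; filter; upTo)
open import Data.List.Membership.Propositional using (_∈_; _∉_)
open import Data.List.Properties using (map-cong; map-++; map-upTo; map-applyUpTo; upTo-∷ʳ)
open import Data.List.Relation.Unary.All as All using (All; []; _∷_)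
open import Data.List.Relation.Unary.AllPairs using ([]; _∷_)
open import Data.List.Relation.Unary.Any using (here; there)
open import Data.Nat
open import Data.Nat.Induction using (<-rec)
open import Data.Nat.ListAction using (sum)
open import Data.Nat.ListAction.Properties using (sum-++)
open import Data.Nat.Properties
open import Data.Nat.Tactic.RingSolver using (solve-∀)
open import Data.Product using (_,_; proj₁; proj₂)
open import Function using (_∘_)
open import Relation.Binary using (tri<; tri≈; tri>)
open import Relation.Binary.PropositionalEquality using (_≡_; refl; sym; trans; cong; subst; module ≡-Reasoning)
open import Relation.Nullary using (¬_; yes; no; does)
open import Relation.Nullary.Decidable using (dec-true; dec-false)
open import Relation.Unary using (Decidable)

sum-map-filter : ∀ {A : Set} {P : A → Set} (P? : Decidable P) (f : A → ℕ) xs →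
  sum (map f (filter P? xs)) ≡ sum (map (λ x → if does (P? x) then f x else 0) xs)
sum-map-filter P? f [] = refl
sum-map-filter P? f (x ∷ xs) with does (P? x)
... | true  = cong (f x +_) (sum-map-filter P? f xs)
... | false = sum-map-filter P? f xs

sum-map-upTo-suc : ∀ (f : ℕ → ℕ) n →
  sum (map f (upTo (suc n))) ≡ f 0 + sum (map (f ∘ suc) (upTo n))
sum-map-upTo-suc f n =
  cong (λ xs → f 0 + sum xs) (trans (map-applyUpTo suc f n) (sym (map-upTo (f ∘ suc) n)))

sum-map-upTo-vanishing : ∀ {f : ℕ → ℕ} {m} N → (∀ i → m ≤ i → f i ≡ 0) → m ≤ N →
  sum (map f (upTo N)) ≡ sum (map f (upTo m))
sum-map-upTo-vanishing {f} {m} N f≡0 m≤N = go (≤⇒≤′ m≤N)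
  where
  go : ∀ {N} → m ≤′ N → sum (map f (upTo N)) ≡ sum (map f (upTo m))
  go ≤′-refl = refl
  go {suc N} (≤′-step m≤′N) = begin
    sum (map f (upTo (suc N)))            ≡⟨ cong (sum ∘ map f) (upTo-∷ʳ N) ⟨
    sum (map f (upTo N ∷ʳ N))             ≡⟨ cong sum (map-++ f (upTo N) [ N ]) ⟩
    sum (map f (upTo N) ++ [ f N ])       ≡⟨ sum-++ (map f (upTo N)) [ f N ] ⟩
    sum (map f (upTo N)) + (f N + 0)      ≡⟨ cong (λ x → sum (map f (upTo N)) + (x + 0)) (f≡0 N (≤′⇒≤ m≤′N)) ⟩
    sum (map f (upTo N)) + 0              ≡⟨ +-identityʳ _ ⟩
    sum (map f (upTo N))                  ≡⟨ go m≤′N ⟩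
    sum (map f (upTo m))                  ∎
    where open ≡-Reasoning

module StepSum (a : ℕ → ℕ) (d : ℕ) where

  stepTerm : ℕ → ℕ → ℕ
  stepTerm n i = if does (i * d <? n) then a (n ∸ i * d) else 0

  stepSum≡sum-stepTerm : ∀ n → stepSum a d n ≡ sum (map (stepTerm n) (upTo n))
  stepSum≡sum-stepTerm n = sum-map-filter (λ i → i * d <? n) (λ i → a (n ∸ i * d)) (upTo n)

  stepTerm-< : ∀ {n} i → i * d < n → stepTerm n i ≡ a (n ∸ i * d)
  stepTerm-< {n} i i*d<n rewrite dec-true (i * d <? n) i*d<n = refl

  stepTerm-≮ : ∀ {n} i → ¬ (i * d < n) → stepTerm n i ≡ 0
  stepTerm-≮ {n} i i*d≮n rewrite dec-false (i * d <? n) i*d≮n = refl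

  stepTerm-suc : ∀ {n} i → d ≤ n → stepTerm n (suc i) ≡ stepTerm (n ∸ d) i
  stepTerm-suc {n} i d≤n with i * d <? n ∸ d
  ... | yes i*d<n∸d = begin
    stepTerm n (suc i)   ≡⟨ stepTerm-< (suc i) (subst (_< n) (+-comm (i * d) d) (m≤o∸n⇒m+n≤o (suc (i * d)) d≤n i*d<n∸d)) ⟩
    a (n ∸ (d + i * d))  ≡⟨ cong a (∸-+-assoc n d (i * d)) ⟨
    a (n ∸ d ∸ i * d)    ≡⟨ stepTerm-< i i*d<n∸d ⟨
    stepTerm (n ∸ d) i   ∎
    where open ≡-Reasoning
  ... | no i*d≮n∸d = trans
    (stepTerm-≮ (suc i) (i*d≮n∸d ∘ m+n≤o⇒m≤o∸n (suc (i * d)) ∘ subst (_< n) (+-comm d (i * d))))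
    (sym (stepTerm-≮ i i*d≮n∸d))

  stepSum-suc : ∀ n → stepSum a d (suc n) ≡ a (suc n) + sum (map (stepTerm (suc n) ∘ suc) (upTo n))
  stepSum-suc n = trans (stepSum≡sum-stepTerm (suc n)) (sum-map-upTo-suc (stepTerm (suc n)) n)

  stepSum-≤ : ∀ {n} → 1 ≤ n → n ≤ d → stepSum a d n ≡ a n
  stepSum-≤ {suc n} _ 1+n≤d = begin
    stepSum a d (suc n)                                      ≡⟨ stepSum-suc n ⟩
    a (suc n) + sum (map (stepTerm (suc n) ∘ suc) (upTo n))  ≡⟨ cong (a (suc n) +_) (sum-map-upTo-vanishing n vanishing z≤n) ⟩
    a (suc n) + 0                                            ≡⟨ +-identityʳ (a (suc n)) ⟩
    a (suc n)                                                ∎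
    where
    open ≡-Reasoning
    vanishing : ∀ i → 0 ≤ i → stepTerm (suc n) (suc i) ≡ 0
    vanishing i _ = stepTerm-≮ (suc i) (≤⇒≯ (≤-trans 1+n≤d (m≤m+n d (i * d))))

  stepSum-> : 1 ≤ d → ∀ {n} → d < n → stepSum a d n ≡ a n + stepSum a d (n ∸ d)
  stepSum-> 1≤d {suc n} d<1+n = begin
    stepSum a d (suc n)                                      ≡⟨ stepSum-suc n ⟩
    a (suc n) + sum (map (stepTerm (suc n) ∘ suc) (upTo n))  ≡⟨ cong (λ xs → a (suc n) + sum xs) (map-cong (λ i → stepTerm-suc i (<⇒≤ d<1+n)) (upTo n)) ⟩
    a (suc n) + sum (map (stepTerm m) (upTo n))              ≡⟨ cong (a (suc n) +_) (sum-map-upTo-vanishing n vanishing (∸-monoʳ-≤ (suc n) 1≤d)) ⟩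
    a (suc n) + sum (map (stepTerm m) (upTo m))              ≡⟨ cong (a (suc n) +_) (stepSum≡sum-stepTerm m) ⟨
    a (suc n) + stepSum a d m                                ∎
    where
    open ≡-Reasoning
    m = suc n ∸ d
    vanishing : ∀ i → m ≤ i → stepTerm m i ≡ 0
    vanishing i m≤i = stepTerm-≮ i (≤⇒≯ (≤-trans m≤i (m≤m*n i d {{>-nonZero 1≤d}})))

module LIDSequence (S : List ℕ) (S-pos : All (λ s → 1 ≤ s) S) (k : ℕ) (S≤k : All (λ s → s ≤ k) S)
                   (a : ℕ → ℕ) (a-LID : IsLID S a) where

  0∉S : 0 ∉ S
  0∉S 0∈S with () ← All.lookup S-pos 0∈S

  ∣i-i∣∉S : ∀ i → ∣ i - i ∣ ∉ S
  ∣i-i∣∉S i = subst (_∉ S) (sym (∣n-n∣≡0 i)) 0∉S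

  >k⇒∉S : ∀ {x} → k < x → x ∉ S
  >k⇒∉S k<x x∈S = <⇒≱ k<x (All.lookup S≤k x∈S)

  Representable-mono : ∀ {n n′ m} → n ≤ n′ → Representable S a n m → Representable S a n′ m
  Representable-mono n≤n′ (L , (L-bounded , L-unique , L-legal) , ΣL≡m) =
    L , (All.map (λ (1≤l , l<n) → 1≤l , <-≤-trans l<n n≤n′) L-bounded , L-unique , L-legal) , ΣL≡m

  Representable-singleton : ∀ {i} → 1 ≤ i → Representable S a (suc i) (a i)
  Representable-singleton {i} 1≤i =
    [ i ] , (((1≤i , ≤-refl) ∷ []) , ([] ∷ []) , legal) , +-identityʳ (a i)
    where
    legal : ∀ {x y} → x ∈ [ i ] → y ∈ [ i ] → ∣ x - y ∣ ∉ S
    legal (here refl) (here refl) = ∣i-i∣∉S i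

  -- m + k is more than k, hence farther than any element of S, from every index below m.
  Representable-add-far : ∀ {m r} → 1 ≤ m → Representable S a m r →
    Representable S a (suc (m + k)) (a (m + k) + r)
  Representable-add-far {m} 1≤m (L , (L-bounded , L-unique , L-legal) , ΣL≡r) =
    (j ∷ L) ,
    ( ((≤-trans 1≤m (m≤m+n m k) , ≤-refl) ∷ All.map (λ (1≤l , l<m) → 1≤l , m<n⇒m<1+n (l<j l<m)) L-bounded)
    , (All.map (λ (_ , l<m) j≡l → <⇒≢ (l<j l<m) (sym j≡l)) L-bounded ∷ L-unique)
    , legal )
    , cong (a j +_) ΣL≡r
    where
    j = m + k
    l<j : ∀ {l} → l < m → l < j
    l<j l<m = <-≤-trans l<m (m≤m+n m k)
    far : ∀ {l} → l < m → ∣ j - l ∣ ∉ S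
    far {l} l<m = subst (_∉ S) (sym (m≤n⇒∣n-m∣≡n∸m (<⇒≤ (l<j l<m))))
      (>k⇒∉S (m+n≤o⇒m≤o∸n (suc k) (subst (_≤ j) (cong suc (+-comm l k)) (+-monoˡ-≤ k l<m))))
    legal : ∀ {x y} → x ∈ j ∷ L → y ∈ j ∷ L → ∣ x - y ∣ ∉ S
    legal (here refl) (here refl) = ∣i-i∣∉S j
    legal (here refl) (there y∈L) = far (proj₂ (All.lookup L-bounded y∈L))
    legal (there x∈L) (here refl) = subst (_∉ S) (∣-∣-comm j _) (far (proj₂ (All.lookup L-bounded x∈L)))
    legal (there x∈L) (there y∈L) = L-legal x∈L y∈L

  a-pos : ∀ {n} → 1 ≤ n → 1 ≤ a n
  a-pos 1≤n = proj₁ (a-LID _ 1≤n)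

  a-nonRepresentable : ∀ {n} → 1 ≤ n → ¬ Representable S a n (a n)
  a-nonRepresentable 1≤n = proj₁ (proj₂ (a-LID _ 1≤n))

  <a⇒Representable : ∀ {n m} → 1 ≤ n → 1 ≤ m → m < a n → Representable S a n m
  <a⇒Representable 1≤n = proj₂ (proj₂ (a-LID _ 1≤n)) _

  a[n]<a[1+n] : ∀ {n} → 1 ≤ n → a n < a (suc n)
  a[n]<a[1+n] {n} 1≤n with <-cmp (a n) (a (suc n))
  ... | tri< a[n]<a[1+n] _ _ = a[n]<a[1+n]
  ... | tri≈ _ a[n]≡a[1+n] _ = ⊥-elim (a-nonRepresentable (s≤s z≤n)
    (subst (Representable S a (suc n)) a[n]≡a[1+n] (Representable-singleton 1≤n)))
  ... | tri> _ _ a[1+n]<a[n] = ⊥-elim (a-nonRepresentable (s≤s z≤n)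
    (Representable-mono (n≤1+n n) (<a⇒Representable 1≤n (a-pos (s≤s z≤n)) a[1+n]<a[n])))

  a-mono-≤ : ∀ {i j} → 1 ≤ i → i ≤ j → a i ≤ a j
  a-mono-≤ {i} 1≤i i≤j = go (≤⇒≤′ i≤j)
    where
    go : ∀ {j} → i ≤′ j → a i ≤ a j
    go ≤′-refl = ≤-refl
    go (≤′-step i≤′j) = ≤-trans (go i≤′j) (<⇒≤ (a[n]<a[1+n] (≤-trans 1≤i (≤′⇒≤ i≤′j))))

  -- Otherwise a (1 + m + k) − a (m + k) < a m would be representable below m, and adding
  -- the far index m + k would represent a (1 + m + k).
  a[m+k]+a[m]≤a[1+m+k] : ∀ {m} → 1 ≤ m → a (m + k) + a m ≤ a (suc (m + k))
  a[m+k]+a[m]≤a[1+m+k] {m} 1≤m = ≮⇒≥ λ a[1+j]<a[j]+a[m] →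
    a-nonRepresentable (s≤s z≤n) (subst (Representable S a (suc j)) (m+[n∸m]≡n (<⇒≤ a[j]<a[1+j]))
      (Representable-add-far 1≤m (<a⇒Representable 1≤m (m<n⇒0<n∸m a[j]<a[1+j])
        (m<n+o⇒m∸n<o (a (suc j)) (a j) {{>-nonZero (a-pos 1≤m)}} a[1+j]<a[j]+a[m]))))
    where
    j = m + k
    a[j]<a[1+j] : a j < a (suc j)
    a[j]<a[1+j] = a[n]<a[1+n] (≤-trans 1≤m (m≤m+n m k))

  a[n]+a[m]+a[1+m]≤a[2+m+k] : ∀ {n m} → 1 ≤ n → 1 ≤ m → n ≤ m + k →
    a n + (a m + a (suc m)) ≤ a (suc (suc (m + k)))
  a[n]+a[m]+a[1+m]≤a[2+m+k] {n} {m} 1≤n 1≤m n≤m+k = begin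
    a n + (a m + a (suc m))        ≤⟨ +-monoˡ-≤ (a m + a (suc m)) (a-mono-≤ 1≤n n≤m+k) ⟩
    a (m + k) + (a m + a (suc m))  ≡⟨ +-assoc (a (m + k)) (a m) (a (suc m)) ⟨
    a (m + k) + a m + a (suc m)    ≤⟨ +-monoˡ-≤ (a (suc m)) (a[m+k]+a[m]≤a[1+m+k] 1≤m) ⟩
    a (suc (m + k)) + a (suc m)    ≤⟨ a[m+k]+a[m]≤a[1+m+k] (s≤s z≤n) ⟩
    a (suc (suc (m + k)))          ∎
    where open ≤-Reasoning

  stepSum<a[n+e] : ∀ {d e} → d ≤ k → e ≤ d → k + 2 ≤ d + e →
    ∀ {n} → 1 ≤ n → stepSum a d n < a (n + e)
  stepSum<a[n+e] {d} {e} d≤k e≤d k+2≤d+e {n} = <-rec P bound n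
    where
    open StepSum a d
    P : ℕ → Set
    P n = 1 ≤ n → stepSum a d n < a (n + e)
    1≤e : 1 ≤ e
    1≤e = +-cancelˡ-≤ k 1 e (≤-trans (+-monoʳ-≤ k (s≤s z≤n)) (≤-trans k+2≤d+e (+-monoˡ-≤ e d≤k)))
    1≤d : 1 ≤ d
    1≤d = ≤-trans 1≤e e≤d
    a[n]<a[n+e] : ∀ {n} → 1 ≤ n → a n < a (n + e)
    a[n]<a[n+e] {n} 1≤n =
      <-≤-trans (a[n]<a[1+n] 1≤n) (a-mono-≤ (s≤s z≤n) (subst (_≤ n + e) (+-comm n 1) (+-monoʳ-≤ n 1≤e)))
    stepSum<a[m]+a[1+m] : ∀ {m} → 1 ≤ m → (d < m → P (m ∸ d)) → stepSum a d m < a m + a (suc m)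
    stepSum<a[m]+a[1+m] {m} 1≤m ih with m ≤? d
    ... | yes m≤d = subst (_< a m + a (suc m)) (sym (stepSum-≤ 1≤m m≤d)) (m<m+n (a m) (a-pos (s≤s z≤n)))
    ... | no m≰d = subst (_< a m + a (suc m)) (sym (stepSum-> 1≤d d<m))
      (+-monoʳ-< (a m) (<-≤-trans (ih d<m (m+n≤o⇒m≤o∸n 1 d<m)) (a-mono-≤ 1≤m∸d+e m∸d+e≤1+m)))
      where
      d<m = ≰⇒> m≰d
      1≤m∸d+e : 1 ≤ m ∸ d + e
      1≤m∸d+e = ≤-trans 1≤e (m≤n+m e (m ∸ d))
      m∸d+e≤1+m : m ∸ d + e ≤ suc m
      m∸d+e≤1+m = ≤-trans (+-monoʳ-≤ (m ∸ d) e≤d) (≤-trans (≤-reflexive (m∸n+n≡m (<⇒≤ d<m))) (n≤1+n m))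
    bound : ∀ n → (∀ {m} → m < n → P m) → P n
    bound n ih 1≤n with n ≤? d
    ... | yes n≤d = subst (_< a (n + e)) (sym (stepSum-≤ 1≤n n≤d)) (a[n]<a[n+e] 1≤n)
    ... | no n≰d = begin-strict
      stepSum a d n            ≡⟨ stepSum-> 1≤d d<n ⟩
      a n + stepSum a d m      <⟨ +-monoʳ-< (a n) (stepSum<a[m]+a[1+m] 1≤m (λ _ → ih m∸d<n)) ⟩
      a n + (a m + a (suc m))  ≤⟨ a[n]+a[m]+a[1+m]≤a[2+m+k] 1≤n 1≤m n≤m+k ⟩
      a (suc (suc (m + k)))    ≤⟨ a-mono-≤ (s≤s z≤n) 2+m+k≤n+e ⟩
      a (n + e)                ∎
      where
      open ≤-Reasoning
      d<n = ≰⇒> n≰d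
      m = n ∸ d
      m+d≡n : m + d ≡ n
      m+d≡n = m∸n+n≡m (<⇒≤ d<n)
      1≤m : 1 ≤ m
      1≤m = m+n≤o⇒m≤o∸n 1 d<n
      m∸d<n : m ∸ d < n
      m∸d<n = ≤-<-trans (m∸n≤m m d) (∸-monoʳ-< 1≤d (<⇒≤ d<n))
      n≤m+k : n ≤ m + k
      n≤m+k = subst (_≤ m + k) m+d≡n (+-monoʳ-≤ m d≤k)
      2+m+k≤n+e : suc (suc (m + k)) ≤ n + e
      2+m+k≤n+e = begin
        suc (suc (m + k))  ≡⟨ trans (+-suc m (suc k)) (cong suc (+-suc m k)) ⟨
        m + suc (suc k)    ≡⟨ cong (m +_) (+-comm 2 k) ⟩
        m + (k + 2)        ≤⟨ +-monoʳ-≤ m k+2≤d+e ⟩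
        m + (d + e)        ≡⟨ +-assoc m d e ⟨
        m + d + e          ≡⟨ cong (_+ e) m+d≡n ⟩
        n + e              ∎

c+2+c≡2[c+1] : ∀ c → c + 2 + c ≡ 2 * (c + 1)
c+2+c≡2[c+1] = solve-∀

k+2≤[k∸c]+[k∸c′] : ∀ {k c c′} → c ≤ c′ → 2 * (c′ + 1) ≤ k → k + 2 ≤ (k ∸ c) + (k ∸ c′)
k+2≤[k∸c]+[k∸c′] {k} {c} {c′} c≤c′ 2[c′+1]≤k = begin
  k + 2         ≡⟨ cong (_+ 2) (m∸n+n≡m c′≤k) ⟨
  x + c′ + 2    ≡⟨ +-assoc x c′ 2 ⟩
  x + (c′ + 2)  ≤⟨ +-monoʳ-≤ x c′+2≤x ⟩
  x + x         ≤⟨ +-monoˡ-≤ x (∸-monoʳ-≤ k c≤c′) ⟩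
  (k ∸ c) + x   ∎
  where
  open ≤-Reasoning
  x = k ∸ c′
  c′+2+c′≤k : c′ + 2 + c′ ≤ k
  c′+2+c′≤k = subst (_≤ k) (sym (c+2+c≡2[c+1] c′)) 2[c′+1]≤k
  c′≤k : c′ ≤ k
  c′≤k = m+n≤o⇒n≤o (c′ + 2) c′+2+c′≤k
  c′+2≤x : c′ + 2 ≤ x
  c′+2≤x = m+n≤o⇒m≤o∸n (c′ + 2) c′+2+c′≤k

corollary3p3 : (S : List ℕ) → All (λ s → 1 ≤ s) S →
    (k c c′ : ℕ) → k ∈ S → All (λ s → s ≤ k) S →
    1 ≤ c → c < k → (k ∸ c) ∉ S → (∀ m → 1 ≤ m → m < k ∸ c → m ∈ S) →
    (a : ℕ → ℕ) → IsLID S a →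
    c ≤ c′ → 2 * (c′ + 1) ≤ k →
    ∀ n → 1 ≤ n → stepSum a (k ∸ c) n < a (n + (k ∸ c′))
corollary3p3 S S-pos k c c′ _ S≤k _ _ _ _ a a-LID c≤c′ 2[c′+1]≤k n 1≤n =
  stepSum<a[n+e] (m∸n≤m k c) (∸-monoʳ-≤ k c≤c′) (k+2≤[k∸c]+[k∸c′] c≤c′ 2[c′+1]≤k) 1≤n
  where open LIDSequence S S-pos k S≤k a a-LID
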